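{- Let $\Phi$ be an integral gain graph on a finite vertex set $V\subset\mathbb{N}$, let $h$ be a height function on $V$ with corner $c$, and let $A$ be a spanning tree of $\Phi[h]$ which is an NBC tree of $\Phi[h]$ with respect to the order $O_h$. Let $A_1,\dots,A_m$ be the connected components of the forest obtained from $A$ by deleting the vertex $c$, with vertex sets $V_1,\dots,V_m$. Then for each $i$, the function $h_i:=h|_{V_i}-\min_{v\in V_i}h(v)$ is the height function of the tree $A_i$, the order $O_{h_i}$ (on $V_i$ and on the edges coherent with $h_i$) is the restriction of $O_h$, and $A_i$ is an NBC tree of $\Phi_{V_i}[h_i]$ with respect to $O_{h_i}$, where $\Phi_{V_i}$ denotes the subgraph of $\Phi$ induced on $V_i$.
   Context: An integral gain graph $\Phi$ on a vertex set $V$ is a loopless multigraph in which each edge carries an integer gain, orientably: writing $g(i,j)$ for an edge oriented from $i$ to $j$ with gain $g$, the same edge oriented from $j$ to $i$ is $(-g)(j,i)$. A circle is a connected 2-regular subgraph; its gain is the sum of the gains of its edges traversed cyclically in one direction, and it is balanced if its gain is $0$. Given a total order on an edge set, a broken circuit is a balanced circle minus its smallest edge; an NBC set is an edge set containing no circle and no broken circuit; an NBC tree is an NBC set forming a spanning tree (of the given vertex set). A height function on a finite $V\subset\mathbb{N}$ is a function $h:V\to\mathbb{N}$ with $h^{ -1}(0)\neq\emptyset$; its corner is the smallest integer among the vertices of greatest height. An edge $g(i,j)$ is coherent with $h$ if $h(j)-h(i)=g$; $\Phi[h]$ is the spanning subgraph of $\Phi$ consisting of the edges coherent with $h$ (all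 its circles are balanced, and it has at most one edge between any two vertices). The order $O_h$ on $V$: $i<_{O_h}j$ iff $h(i)>h(j)$, or $h(i)=h(j)$ and $i<j$; it is extended to edges coherent with $h$ lexicographically (write each edge as the pair of its endpoints in $O_h$-increasing order and compare pairs lexicographically). The height function of a tree $T$ whose edges have integer gains is the unique height function on its vertex set with respect to which all edges of $T$ are coherent. -}

module Defs where

open import Data.Nat using (ℕ; zero; suc; _≤_; _<_; _∸_)
open import Data.Integer as ℤ using (ℤ; +_; 0ℤ)
open import Data.Fin using (Fin; zero; suc; fromℕ; inject₁)
open import Data.List using (List)
open import Data.List.Membership.Propositional using (_∈_)
open import Data.Product using (Σ; ∃; _×_; _,_)
open import Data.Sum using (_⊎_)
open import Relation.Nullary using (¬_)
open import Relation.Binary.PropositionalEquality using (_≡_; _≢_)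
open import Function.Bundles using (_⇔_)

-- Edges are indexed by Fin n (so parallel edges,
-- even with equal gains, are distinct).  Edge e is oriented from tl e to
-- hd e with gain  gain e ; traversed from hd e to tl e it has gain - gain e.

record GainGraph : Set where
  field
    V     : List ℕ
    n     : ℕ
    tl hd : Fin n → ℕ
    gain  : Fin n → ℤ
    loopless : ∀ e → tl e ≢ hd e
    tl∈V     : ∀ e → tl e ∈ V
    hd∈V     : ∀ e → hd e ∈ V

VSet : Set₁
VSet = ℕ → Set

module _ (Φ : GainGraph) where
  open GainGraph Φ

  ESet : Set₁
  ESet = Fin n → Set

  Joins : Fin n → ℕ → ℕ → Set
  Joins e u v = (tl e ≡ u × hd e ≡ v) ⊎ (tl e ≡ v × hd e ≡ u)

  data TravGain (e : Fin n) (u : ℕ) : ℤ → Set where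
    fwd : tl e ≡ u → TravGain e u (gain e)
    bwd : hd e ≡ u → TravGain e u (ℤ.- gain e)

  -- A circle with edges in S: a closed walk v₀ e₀ v₁ … e_{k-1} v_k = v₀,
  -- k ≥ 2, with distinct vertices v₀ … v_{k-1} and distinct edges.
  record Circle (S : ESet) : Set where
    field
      k      : ℕ
      2≤k    : 2 ≤ k
      vs     : Fin (suc k) → ℕ
      es     : Fin k → Fin n
      closed : vs (fromℕ k) ≡ vs zero
      vinj   : ∀ s t → vs (inject₁ s) ≡ vs (inject₁ t) → s ≡ t
      einj   : ∀ s t → es s ≡ es t → s ≡ t
      inS    : ∀ t → S (es t)
      joins  : ∀ t → Joins (es t) (vs (inject₁ t)) (vs (suc t))

  sumℤ : ∀ {k} → (Fin k → ℤ) → ℤ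
  sumℤ {zero}  f = 0ℤ
  sumℤ {suc k} f = f zero ℤ.+ sumℤ (λ t → f (suc t))

  Balanced : ∀ {S} → Circle S → Set
  Balanced C = Σ (Fin k → ℤ) λ g →
                 (∀ t → TravGain (es t) (vs (inject₁ t)) (g t)) × sumℤ g ≡ 0ℤ
    where open Circle C

  ContainsBC : ESet → (Fin n → Fin n → Set) → ESet → Set
  ContainsBC P _≺_ S =
    Σ (Circle P) λ C → let open Circle C in
      Balanced C × Σ (Fin k) λ t₀ →
        (∀ t → t ≢ t₀ → es t₀ ≺ es t) × (∀ t → t ≢ t₀ → S (es t))

  HasCircle : ESet → Set
  HasCircle S = Circle S

  IsNBCSet : ESet → (Fin n → Fin n → Set) → ESet → Set
  IsNBCSet P _≺_ S = (∀ e → S e → P e) × ¬ HasCircle S × ¬ ContainsBC P _≺_ S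

  data Reach (S : ESet) : ℕ → ℕ → Set where
    here : ∀ {u} → Reach S u u
    step : ∀ {u v w} e → S e → Joins e u v → Reach S v w → Reach S u w

  IsSpanningTree : VSet → ESet → ESet → Set
  IsSpanningTree W P S =
    (∀ e → S e → P e) × (∀ e → S e → W (tl e) × W (hd e)) ×
    ¬ HasCircle S × (∀ u v → W u → W v → Reach S u v)

  IsNBCTree : VSet → ESet → (Fin n → Fin n → Set) → ESet → Set
  IsNBCTree W P _≺_ S = IsNBCSet P _≺_ S × IsSpanningTree W P S

  IsHeight : VSet → (ℕ → ℕ) → Set
  IsHeight W h = ∃ λ v → W v × h v ≡ 0

  IsCorner : VSet → (ℕ → ℕ) → ℕ → Set
  IsCorner W h c = W c × (∀ v → W v → h v ≤ h c) × (∀ v → W v → h v ≡ h c → c ≤ v)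

  Coherent : (ℕ → ℕ) → Fin n → Set
  Coherent h e = (+ h (hd e)) ℤ.- (+ h (tl e)) ≡ gain e

  Φ[_] : (ℕ → ℕ) → ESet
  Φ[ h ] e = Coherent h e

  _<[_]_ : ℕ → (ℕ → ℕ) → ℕ → Set
  i <[ h ] j = h j < h i ⊎ (h i ≡ h j × i < j)

  OrdEnds : (ℕ → ℕ) → Fin n → ℕ → ℕ → Set
  OrdEnds h e a b = Joins e a b × a <[ h ] b

  EdgeLt : (ℕ → ℕ) → Fin n → Fin n → Set
  EdgeLt h e f = ∃ λ a → ∃ λ b → ∃ λ c → ∃ λ d →
    OrdEnds h e a b × OrdEnds h f c d × (a <[ h ] c ⊎ (a ≡ c × b <[ h ] d))

  Del : ESet → ℕ → ESet
  Del A c e = A e × tl e ≢ c × hd e ≢ c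

  Comp : ESet → ℕ → ℕ → VSet
  Comp A c v u = Reach (Del A c) v u

  SubTree : ESet → VSet → ESet
  SubTree A W e = A e × W (tl e) × W (hd e)

  Induced : VSet → ESet
  Induced W e = W (tl e) × W (hd e)

  IsMinOn : VSet → (ℕ → ℕ) → ℕ → Set
  IsMinOn W h m = (∃ λ w → W w × h w ≡ m) × (∀ u → W u → m ≤ h u)

module Submission where

-- The
-- whole statement follows from three independent observations.
--   1. Shifting a height function by a constant m that lies below it on W
--      changes neither the height differences along edges inside W (so
--      coherence is unaffected) nor the vertex order O_h on W, hence nor the
--      lexicographic edge order on edges inside W.
--   2. NBC sets are hereditary: a subset S of an NBC set S' contains no
--      circle, and no broken circuit of a smaller edge set P ⊆ P' whose
--      order is the restriction of the order on P'.
--   3. The component W of A − c is connected by the edges of A with both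
--      ends in W, since every edge of A − c leaving a vertex of W stays in W.

open import Defs
open import Data.Nat using (ℕ; _∸_)
open import Data.Fin using (Fin)
open import Data.Product using (_×_)
open import Data.List.Membership.Propositional using (_∈_)
open import Relation.Binary.PropositionalEquality using (_≢_)
open import Function.Bundles using (_⇔_)

open import Data.Nat as ℕ using (_≤_; _<_)
open import Data.Nat.Properties
  using (n∸n≡0; m+[n∸m]≡n; ∸-monoˡ-≤; ∸-monoˡ-<; ∸-cancelʳ-≡; <⇒≱; ≰⇒>)
open import Data.Integer as ℤ using (+_; _⊖_)
open import Data.Integer.Properties using ([+m]-[+n]≡m⊖n; +-cancelˡ-⊖)
open import Data.Product using (_,_; proj₁; proj₂)
open import Data.Sum using (_⊎_; inj₁; inj₂)
open import Relation.Binary.PropositionalEquality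
  using (_≡_; sym; trans; cong; cong₂; subst; module ≡-Reasoning)
open import Function.Bundles using (mk⇔; Equivalence)
open import Relation.Nullary using (¬_)

shift-difference : ∀ m x y → m ≤ x → m ≤ y →
  (+ (y ∸ m)) ℤ.- (+ (x ∸ m)) ≡ (+ y) ℤ.- (+ x)
shift-difference m x y m≤x m≤y = begin
  (+ (y ∸ m)) ℤ.- (+ (x ∸ m))       ≡⟨ [+m]-[+n]≡m⊖n (y ∸ m) (x ∸ m) ⟩
  (y ∸ m) ⊖ (x ∸ m)                 ≡⟨ +-cancelˡ-⊖ m (y ∸ m) (x ∸ m) ⟨
  (m ℕ.+ (y ∸ m)) ⊖ (m ℕ.+ (x ∸ m)) ≡⟨ cong₂ _⊖_ (m+[n∸m]≡n m≤y) (m+[n∸m]≡n m≤x) ⟩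
  y ⊖ x                             ≡⟨ [+m]-[+n]≡m⊖n y x ⟨
  (+ y) ℤ.- (+ x)                   ∎
  where open ≡-Reasoning

shift-reflects-< : ∀ m x y → y ∸ m < x ∸ m → y < x
shift-reflects-< m x y y-m<x-m = ≰⇒> (λ x≤y → <⇒≱ y-m<x-m (∸-monoˡ-≤ m x≤y))

module GainGraphFacts (Φ : GainGraph) where
  open GainGraph Φ

  joins-sym : ∀ {e u v} → Joins Φ e u v → Joins Φ e v u
  joins-sym (inj₁ ends) = inj₂ ends
  joins-sym (inj₂ ends) = inj₁ ends

  reach-trans : ∀ {S u v w} → Reach Φ S u v → Reach Φ S v w → Reach Φ S u w
  reach-trans here            r′ = r′
  reach-trans (step e s j r)  r′ = step e s j (reach-trans r r′)

  reach-sym : ∀ {S u w} → Reach Φ S u w → Reach Φ S w u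
  reach-sym here           = here
  reach-sym (step e s j r) = reach-trans (reach-sym r) (step e s (joins-sym j) here)

  circle-mono : ∀ {S S′ : ESet Φ} → (∀ e → S e → S′ e) → Circle Φ S → Circle Φ S′
  circle-mono S⊆S′ C = record
    { k = k ; 2≤k = 2≤k ; vs = vs ; es = es ; closed = closed
    ; vinj = vinj ; einj = einj ; inS = λ t → S⊆S′ (es t) (inS t) ; joins = joins }
    where open Circle C

  nbc-mono : ∀ {P P′ S S′ : ESet Φ} {_≺_ _≺′_ : Fin n → Fin n → Set} →
    (∀ e → S e → P e) → (∀ e → P e → P′ e) → (∀ e → S e → S′ e) →
    (∀ e f → P e → P f → e ≺ f → e ≺′ f) →
    IsNBCSet Φ P′ _≺′_ S′ → IsNBCSet Φ P _≺_ S
  nbc-mono {P} {P′} {S} {S′} {_≺_} {_≺′_} S⊆P P⊆P′ S⊆S′ ≺⊆≺′ (_ , noCircle , noBC) =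
    S⊆P , (λ C → noCircle (circle-mono S⊆S′ C)) , noBC-small
    where
    noBC-small : ¬ ContainsBC Φ P _≺_ S
    noBC-small (C , balanced , t₀ , least , rest⊆S) =
      noBC ( circle-mono P⊆P′ C , balanced , t₀
           , (λ t t≢t₀ → ≺⊆≺′ _ _ (inS t₀) (inS t) (least t t≢t₀))
           , (λ t t≢t₀ → S⊆S′ _ (rest⊆S t t≢t₀)) )
      where open Circle C

  ends-in : ∀ {W : VSet} {e a b} → Joins Φ e a b → Induced Φ W e → W a × W b
  ends-in {W} (inj₁ (t≡a , h≡b)) (wt , wh) = subst W t≡a wt , subst W h≡b wh
  ends-in {W} (inj₂ (t≡b , h≡a)) (wt , wh) = subst W h≡a wh , subst W t≡b wt

  -- The edge order is built from the vertex order alone, so an implication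
  -- between vertex orders on W yields one between edge orders on edges in W.
  edgeLt-transfer : ∀ {W : VSet} (h₁ h₂ : ℕ → ℕ) →
    (∀ a b → W a → W b → _<[_]_ Φ a h₁ b → _<[_]_ Φ a h₂ b) →
    ∀ e f → Induced Φ W e → Induced Φ W f → EdgeLt Φ h₁ e f → EdgeLt Φ h₂ e f
  edgeLt-transfer {W} h₁ h₂ conv e f inW-e inW-f
    (a , b , c , d , (jab , a<b) , (jcd , c<d) , lex) =
    a , b , c , d , (jab , conv a b wa wb a<b) , (jcd , conv c d wc wd c<d) , lex′ lex
    where
    wa = proj₁ (ends-in {W} jab inW-e)
    wb = proj₂ (ends-in {W} jab inW-e)
    wc = proj₁ (ends-in {W} jcd inW-f)
    wd = proj₂ (ends-in {W} jcd inW-f)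
    lex′ : _<[_]_ Φ a h₁ c ⊎ (a ≡ c × _<[_]_ Φ b h₁ d) →
           _<[_]_ Φ a h₂ c ⊎ (a ≡ c × _<[_]_ Φ b h₂ d)
    lex′ (inj₁ a<c)         = inj₁ (conv a c wa wc a<c)
    lex′ (inj₂ (a≡c , b<d)) = inj₂ (a≡c , conv b d wb wd b<d)

  module Shift (W : VSet) (h : ℕ → ℕ) (m : ℕ) (m≤h : ∀ u → W u → m ≤ h u) where

    hₘ : ℕ → ℕ
    hₘ u = h u ∸ m

    coherent-shift : ∀ e → Induced Φ W e → (Coherent Φ hₘ e ⇔ Coherent Φ h e)
    coherent-shift e (wt , wh) =
      mk⇔ (trans (sym same-difference)) (trans same-difference)
      where
      same-difference = shift-difference m (h (tl e)) (h (hd e)) (m≤h _ wt) (m≤h _ wh)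

    order-shift : ∀ a b → W a → W b → (_<[_]_ Φ a hₘ b ⇔ _<[_]_ Φ a h b)
    order-shift a b wa wb = mk⇔ reflect preserve
      where
      reflect : _<[_]_ Φ a hₘ b → _<[_]_ Φ a h b
      reflect (inj₁ lt)         = inj₁ (shift-reflects-< m (h a) (h b) lt)
      reflect (inj₂ (eq , a<b)) = inj₂ (∸-cancelʳ-≡ (m≤h a wa) (m≤h b wb) eq , a<b)
      preserve : _<[_]_ Φ a h b → _<[_]_ Φ a hₘ b
      preserve (inj₁ lt)         = inj₁ (∸-monoˡ-< lt (m≤h b wb))
      preserve (inj₂ (eq , a<b)) = inj₂ (cong (_∸ m) eq , a<b)

    edgeOrder-shift : ∀ e f → Induced Φ W e → Induced Φ W f →
      (EdgeLt Φ hₘ e f ⇔ EdgeLt Φ h e f)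
    edgeOrder-shift e f inW-e inW-f = mk⇔
      (edgeLt-transfer {W} hₘ h (λ a b wa wb → Equivalence.to (order-shift a b wa wb))
                       e f inW-e inW-f)
      (edgeLt-transfer {W} h hₘ (λ a b wa wb → Equivalence.from (order-shift a b wa wb))
                       e f inW-e inW-f)

  -- The component W of A − c containing v is connected by the edges of A
  -- having both ends in W: walks in A − c starting in W never leave W.
  module Component (A : ESet Φ) (c v : ℕ) where

    W : VSet
    W = Comp Φ A c v

    walk-inside : ∀ {x u} → W x → Reach Φ (Del Φ A c) x u → Reach Φ (SubTree Φ A W) x u
    walk-inside wx here = here
    walk-inside {x} wx (step {v = y} e d@(ae , _ , _) j r) =
      step e (ae , ends j) j (walk-inside wy r)
      where
      wy : W y
      wy = reach-trans wx (step e d j here)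
      ends : Joins Φ e x y → W (tl e) × W (hd e)
      ends (inj₁ (t≡x , h≡y)) = subst W (sym t≡x) wx , subst W (sym h≡y) wy
      ends (inj₂ (t≡y , h≡x)) = subst W (sym t≡y) wy , subst W (sym h≡x) wx

    connected : ∀ u u′ → W u → W u′ → Reach Φ (SubTree Φ A W) u u′
    connected u u′ wu wu′ = reach-trans (reach-sym (walk-inside here wu)) (walk-inside here wu′)

open GainGraphFacts

mainTheorem1 : (Φ : GainGraph) → let open GainGraph Φ in
    (h : ℕ → ℕ) → IsHeight Φ (_∈ V) h →
    (c : ℕ) → IsCorner Φ (_∈ V) h c →
    (A : Fin n → Set) → IsNBCTree Φ (_∈ V) (Φ[_] Φ h) (EdgeLt Φ h) A →
    (v : ℕ) → v ∈ V → v ≢ c →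
    let W = Comp Φ A c v
        Aᵢ = SubTree Φ A W in
    (m : ℕ) → IsMinOn Φ W h m →
    let hᵢ = λ u → h u ∸ m in
    (IsHeight Φ W hᵢ × (∀ e → Aᵢ e → Coherent Φ hᵢ e))
    × (∀ a b → W a → W b → (_<[_]_ Φ a hᵢ b ⇔ _<[_]_ Φ a h b))
    × (∀ e f → Induced Φ W e → Coherent Φ hᵢ e → Induced Φ W f → Coherent Φ hᵢ f →
         Coherent Φ h e × (EdgeLt Φ hᵢ e f ⇔ EdgeLt Φ h e f))
    × IsNBCTree Φ W (λ e → Induced Φ W e × Coherent Φ hᵢ e) (EdgeLt Φ hᵢ) Aᵢ
mainTheorem1 Φ h _ c _ A (nbcSet@(A⊆Φ[h] , noCircle , _) , _) v _ _ m
             ((w , ww , hw≡m) , m≤h) =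
  (hᵢ-height , Aᵢ-coherent) , order-shift , edges , (Aᵢ-nbc , Aᵢ-spanning)
  where
  open Component Φ A c v
  open Shift Φ W h m m≤h

  hᵢ-height : IsHeight Φ W hₘ
  hᵢ-height = w , ww , trans (cong (_∸ m) hw≡m) (n∸n≡0 m)

  Aᵢ-coherent : ∀ e → SubTree Φ A W e → Coherent Φ hₘ e
  Aᵢ-coherent e (ae , inW) = Equivalence.from (coherent-shift e inW) (A⊆Φ[h] e ae)

  Aᵢ-in-Φ[hᵢ] : ∀ e → SubTree Φ A W e → Induced Φ W e × Coherent Φ hₘ e
  Aᵢ-in-Φ[hᵢ] e aᵢe@(_ , inW) = inW , Aᵢ-coherent e aᵢe

  edges : ∀ e f → Induced Φ W e → Coherent Φ hₘ e → Induced Φ W f → Coherent Φ hₘ f →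
          Coherent Φ h e × (EdgeLt Φ hₘ e f ⇔ EdgeLt Φ h e f)
  edges e f inW-e coh-e inW-f _ =
    Equivalence.to (coherent-shift e inW-e) coh-e , edgeOrder-shift e f inW-e inW-f

  Aᵢ-nbc : IsNBCSet Φ (λ e → Induced Φ W e × Coherent Φ hₘ e) (EdgeLt Φ hₘ) (SubTree Φ A W)
  Aᵢ-nbc = nbc-mono Φ Aᵢ-in-Φ[hᵢ]
    (λ e (inW , coh) → Equivalence.to (coherent-shift e inW) coh)
    (λ e → proj₁)
    (λ e f (inW-e , _) (inW-f , _) → Equivalence.to (edgeOrder-shift e f inW-e inW-f))
    nbcSet

  Aᵢ-spanning : IsSpanningTree Φ W (λ e → Induced Φ W e × Coherent Φ hₘ e) (SubTree Φ A W)
  Aᵢ-spanning = Aᵢ-in-Φ[hᵢ] , (λ e → proj₂) ,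
    (λ C → noCircle (circle-mono Φ (λ e → proj₁) C)) , connected
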